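{- The sets $\mathit{Share}(\mathbf{Inf})$, $\mathit{Share}^\ast(\mathbf{Inf})$ and $\mathit{Share}^\ast_{01}(\mathbf{Inf})$ are, each of them, complete analytic sets.
   Context: Framework: Brouwer's intuitionistic analysis (intuitionistic logic, countable choice, Brouwer's Continuity Principle, axioms of continuous choice, Thesis on Bars, Fan Theorem). $\mathcal N=\mathbb N^{\mathbb N}$, $\mathcal C=\{\alpha:\forall n\,\alpha(n)\le1\}$. Finite sequences are coded by natural numbers, $\overline\alpha n=\langle\alpha(0),\dots,\alpha(n-1)\rangle$, $*$ concatenation. $\beta$ admits $\alpha$ iff $\forall n\,\beta(\overline\alpha n)=0$; $F_\beta$ = set of $\alpha$ admitted by $\beta$ (the closed sets). $\mathit{Share}(X)=\{\beta:F_\beta\text{ contains an element of }X\}$. $\beta$ is a spread-law iff $\forall s[\beta(s)=0\leftrightarrow\exists n\,\beta(s*\langle n\rangle)=0]$; $\mathit{Share}^\ast(X)$ is the set of spread-laws in $\mathit{Share}(X)$; $\mathit{Share}^\ast_{01}(X)$ is the set of $\beta\in\mathit{Share}(X)$ such that for every $s$: $\beta(s)=0$ iff ($\beta(s*\langle0\rangle)=0$ or $\beta(s*\langle1\rangle)=0$), and $\beta(s*\langle i\rangle)\ne0$ for all $i>1$. $\mathbf{Inf}=\{\alpha\in\mathcal C:\forall m\exists n>m\,\alpha(n)=1\}$. Functions $\mathcal N\to\mathcal N$ are given by codes $\gamma$ (each $\gamma^n$, $\gamma^n(k)=\gamma(\langle n\rangle*k)$, satisfies $\forall\alpha\exists m\,\gamma^n(\overline\alpha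 m)\ne0$, and $(\gamma|\alpha)(n)=p$ where $\gamma^n(\overline\alpha m)=p+1$ at the least such $m$). $X$ reduces to $Y$ iff some $\gamma$ has $\alpha\in X\leftrightarrow\gamma|\alpha\in Y$ for all $\alpha$. $X$ is analytic iff $X=\{\alpha:\exists\beta\,\langle\alpha,\beta\rangle\in Y\}$ for some closed $Y$, where $\langle\alpha,\beta\rangle(2n)=\alpha(n)$, $\langle\alpha,\beta\rangle(2n+1)=\beta(n)$; complete analytic = analytic and every analytic set reduces to it. -}

module Defs where

open import Data.Nat using (ℕ; zero; suc; _+_; _*_; _^_; _≤_; _<_; pred)
open import Data.List using (List; []; _∷_; _++_; [_]; foldl; applyUpTo)
open import Data.Product using (Σ; ∃; _×_; _,_; proj₁)
open import Data.Sum using (_⊎_)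
open import Relation.Binary.PropositionalEquality using (_≡_; _≢_)
open import Function.Bundles using (_⇔_)

Seq : Set
Seq = ℕ → ℕ

Subset : Set₁
Subset = Seq → Set

-- Coding of finite sequences by natural numbers (a bijection List ℕ → ℕ):
-- ⟨⟩ ↦ 0 and  s * ⟨n⟩ ↦ 2^(code s) * (2n+1).
⌜_⌝ : List ℕ → ℕ
⌜ s ⌝ = foldl (λ c n → 2 ^ c * (1 + 2 * n)) 0 s

prefix : Seq → ℕ → List ℕ
prefix α n = applyUpTo α n

Admits : Seq → Seq → Set
Admits β α = ∀ n → β ⌜ prefix α n ⌝ ≡ 0

F : Seq → Subset
F β = Admits β

Share : Subset → Subset
Share X β = Σ Seq λ α → F β α × X α

IsSpreadLaw : Seq → Set
IsSpreadLaw β = ∀ (s : List ℕ) →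
  (β ⌜ s ⌝ ≡ 0) ⇔ (∃ λ n → β ⌜ s ++ [ n ] ⌝ ≡ 0)

Share* : Subset → Subset
Share* X β = IsSpreadLaw β × Share X β

Share*01 : Subset → Subset
Share*01 X β =
  Share X β
  × (∀ (s : List ℕ) →
       (β ⌜ s ⌝ ≡ 0) ⇔ (β ⌜ s ++ [ 0 ] ⌝ ≡ 0 ⊎ β ⌜ s ++ [ 1 ] ⌝ ≡ 0))
  × (∀ (s : List ℕ) (i : ℕ) → 1 < i → β ⌜ s ++ [ i ] ⌝ ≢ 0)

Inf : Subset
Inf α = (∀ n → α n ≤ 1) × (∀ m → ∃ λ n → m < n × α n ≡ 1)

-- ⟨α, β⟩(2n) = α(n), ⟨α, β⟩(2n+1) = β(n)
interleave : Seq → Seq → Seq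
interleave α β zero = α 0
interleave α β (suc zero) = β 0
interleave α β (suc (suc n)) = interleave (λ k → α (suc k)) (λ k → β (suc k)) n

-- Codes of functions 𝒩 → 𝒩: γⁿ(s) = γ(⟨n⟩ * s), and every γⁿ is
-- eventually nonzero along every α.
IsFunCode : Seq → Set
IsFunCode γ = ∀ (n : ℕ) (α : Seq) → ∃ λ m → γ ⌜ n ∷ prefix α m ⌝ ≢ 0

firstNonzero : (ℕ → ℕ) → ℕ → ℕ
firstNonzero f zero = f 0
firstNonzero f (suc b) with f 0
... | zero = firstNonzero (λ k → f (suc k)) b
... | suc v = suc v

-- (γ|α)(n) = p where γⁿ(ᾱm) = p+1 for the least m with γⁿ(ᾱm) ≠ 0
apply : (γ : Seq) → IsFunCode γ → Seq → Seq
apply γ c α n = pred (firstNonzero (λ m → γ ⌜ n ∷ prefix α m ⌝) (proj₁ (c n α)))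

Reduces : Subset → Subset → Set
Reduces X Y = Σ Seq λ γ → Σ (IsFunCode γ) λ c →
  ∀ α → X α ⇔ Y (apply γ c α)

Analytic : Subset → Set
Analytic X = Σ Seq λ δ → ∀ α → X α ⇔ (∃ λ β → F δ (interleave α β))

CompleteAnalytic : Subset → Set₁
CompleteAnalytic X = Analytic X × (∀ (Y : Subset) → Analytic Y → Reduces Y X)

-- Analyticity. β ∈ Share(Inf) iff there are ζ and ν such that for every n: ζ(n) ≤ 1, n < ν(n),
-- ζ(ν(n)) = 1 and β admits ζ̄n. Each of these conditions is decided by finitely many, adaptively
-- chosen, values of ⟨β, ⟨ζ, ν⟩⟩, so together they define a closed set whose projection is
-- Share(Inf). Being a spread-law becomes such a condition once the witness also contains a choice
-- w(s) of an admitted one-step extension of every admitted s; the extra conditions of Share*₀₁ only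
-- involve β.
--
-- Let Y = {α : ∃β ⟨α, β⟩ ∈ F_δ}. Read a 0-1 sequence t as the list b of the lengths
-- of the runs of 0s closed by its 1s, and send α to the law of the tree of those t for which δ
-- admits ⟨α, b⟩ up to length 2|b|. Its value at t depends on α only through ᾱ|b|, so α ↦ law is
-- continuous; the law is binary and hence a spread-law. A branch with infinitely many 1s decodes to
-- a β with ⟨α, β⟩ ∈ F_δ, and every such β yields the branch 0^β(0) 1 0^β(1) 1 …. So one reduction
-- serves all three sets.

module Submission where

open import Data.Bool using (Bool; true; false; if_then_else_; T)
open import Data.List using (List; []; _∷_; _++_; [_]; _∷ʳ_; foldl; length)
open import Data.List.Properties
  using (foldl-∷ʳ; length-applyUpTo; length-++; applyUpTo-∷ʳ; ++-identityʳ; ++-assoc)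
open import Data.List.Relation.Unary.All using (All; all?)
open import Data.List.Relation.Unary.All.Properties using (∷ʳ⁺; ∷ʳ⁻; applyUpTo⁺₂)
open import Data.List.Reverse using (Reverse; reverseView; []; _∶_∶ʳ_)
open import Data.Nat
open import Data.Nat.Properties
open import Data.Product using (_×_; _,_; proj₁; proj₂; map₁; ∃; ∃₂)
open import Data.Product.Function.NonDependent.Propositional using (_×-⇔_)
open import Data.Sum using (_⊎_; inj₁; inj₂; [_,_]′) renaming (map to map-⊎)
open import Data.Unit using (⊤; tt)
open import Function.Base using (id)
open import Function.Bundles using (_⇔_; mk⇔; Equivalence)
open import Function.Construct.Composition using (_⇔-∘_)
open import Function.Construct.Symmetry using (⇔-sym)
open import Relation.Binary.PropositionalEquality hiding ([_])
open import Relation.Nullary using (Dec; yes; no; does; ¬_; contradiction)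
open import Relation.Nullary.Decidable
  using (_×-dec_; _⊎-dec_; _→-dec_; ¬?; T?; isYes; toWitness; fromWitness)
open import Relation.Unary using (Decidable)

open import Defs

-- Decoding of finite sequences

isOdd : ℕ → Bool
isOdd 0 = false
isOdd 1 = true
isOdd (suc (suc n)) = isOdd n

2*suc : ∀ m → 2 * suc m ≡ suc (suc (2 * m))
2*suc m = cong suc (+-suc m (m + 0))

isOdd-2* : ∀ m → isOdd (2 * m) ≡ false
isOdd-2* zero = refl
isOdd-2* (suc m) rewrite 2*suc m = isOdd-2* m

isOdd-1+2* : ∀ m → isOdd (1 + 2 * m) ≡ true
isOdd-1+2* zero = refl
isOdd-1+2* (suc m) rewrite +-suc m (m + 0) = isOdd-1+2* m

⌊2*/2⌋ : ∀ m → ⌊ 2 * m /2⌋ ≡ m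
⌊2*/2⌋ zero = refl
⌊2*/2⌋ (suc m) rewrite 2*suc m = cong suc (⌊2*/2⌋ m)

⌊1+2*/2⌋ : ∀ m → ⌊ 1 + 2 * m /2⌋ ≡ m
⌊1+2*/2⌋ zero = refl
⌊1+2*/2⌋ (suc m) rewrite +-suc m (m + 0) = cong suc (⌊1+2*/2⌋ m)

-- Splits k = 2 ^ c * (1 + 2 * n) into (c , n), given fuel f > c.
unpair : (fuel : ℕ) → ℕ → ℕ × ℕ
unpair zero k = (0 , 0)
unpair (suc f) k = if isOdd k then (0 , ⌊ k /2⌋) else map₁ suc (unpair f ⌊ k /2⌋)

unpair-2^*odd : ∀ f c n → c < f → unpair f (2 ^ c * (1 + 2 * n)) ≡ (c , n)
unpair-2^*odd (suc f) zero n _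
  rewrite *-identityˡ (1 + 2 * n) | isOdd-1+2* n | ⌊1+2*/2⌋ n = refl
unpair-2^*odd (suc f) (suc c) n (s≤s c<f)
  rewrite *-assoc 2 (2 ^ c) (1 + 2 * n) | isOdd-2* (2 ^ c * (1 + 2 * n))
        | ⌊2*/2⌋ (2 ^ c * (1 + 2 * n)) | unpair-2^*odd f c n c<f = refl

decodeWith : (fuel : ℕ) → ℕ → List ℕ
decodeWith zero k = []
decodeWith (suc f) zero = []
decodeWith (suc f) k@(suc _) = decodeWith f (proj₁ (unpair k k)) ∷ʳ proj₂ (unpair k k)

decode : ℕ → List ℕ
decode k = decodeWith (suc k) k

⌜∷ʳ⌝ : ∀ s n → ⌜ s ∷ʳ n ⌝ ≡ 2 ^ ⌜ s ⌝ * (1 + 2 * n)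
⌜∷ʳ⌝ s n = foldl-∷ʳ (λ c n → 2 ^ c * (1 + 2 * n)) 0 n s

n<2^n : ∀ n → n < 2 ^ n
n<2^n zero = s≤s z≤n
n<2^n (suc n) = +-mono-≤ (m^n>0 2 n) (≤-trans (n<2^n n) (m≤m+n _ 0))

c<2^c*odd : ∀ c n → c < 2 ^ c * (1 + 2 * n)
c<2^c*odd c n = <-≤-trans (n<2^n c) (m≤m*n (2 ^ c) (1 + 2 * n))

decodeWith-suc : ∀ f k → 0 < k →
  decodeWith (suc f) k ≡ decodeWith f (proj₁ (unpair k k)) ∷ʳ proj₂ (unpair k k)
decodeWith-suc f (suc k) _ = refl

decodeWith-⌜⌝ : ∀ f s → Reverse s → ⌜ s ⌝ < f → decodeWith f ⌜ s ⌝ ≡ s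
decodeWith-⌜⌝ (suc f) .[] [] _ = refl
decodeWith-⌜⌝ (suc f) .(s ∷ʳ n) (s ∶ rs ∶ʳ n) k<f = begin
  decodeWith (suc f) ⌜ s ∷ʳ n ⌝
    ≡⟨ cong (decodeWith (suc f)) (⌜∷ʳ⌝ s n) ⟩
  decodeWith (suc f) k
    ≡⟨ decodeWith-suc f k (≤-<-trans z≤n c<k) ⟩
  decodeWith f (proj₁ (unpair k k)) ∷ʳ proj₂ (unpair k k)
    ≡⟨ cong (λ (c , m) → decodeWith f c ∷ʳ m) (unpair-2^*odd k ⌜ s ⌝ n c<k) ⟩
  decodeWith f ⌜ s ⌝ ∷ʳ n
    ≡⟨ cong (_∷ʳ n) (decodeWith-⌜⌝ f s rs (≤-trans c<k k≤f)) ⟩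
  s ∷ʳ n ∎
  where
  open ≡-Reasoning
  k = 2 ^ ⌜ s ⌝ * (1 + 2 * n)
  c<k = c<2^c*odd ⌜ s ⌝ n
  k≤f : k ≤ f
  k≤f = ≤-pred (subst (_< suc f) (⌜∷ʳ⌝ s n) k<f)

decode-⌜⌝ : ∀ s → decode ⌜ s ⌝ ≡ s
decode-⌜⌝ s = decodeWith-⌜⌝ (suc ⌜ s ⌝) s (reverseView s) ≤-refl

-- Laws of decidable sets of finite sequences

if-yes : {A : Set} {x y : ℕ} (a? : Dec A) → A → (if does a? then x else y) ≡ x
if-yes (yes _) _ = refl
if-yes (no ¬a) a = contradiction a ¬a

if-no : {A : Set} {x y : ℕ} (a? : Dec A) → ¬ A → (if does a? then x else y) ≡ y
if-no (yes a) ¬a = contradiction a ¬a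
if-no (no _) _ = refl

zeroIf : {A : Set} → Dec A → ℕ
zeroIf a? = if does a? then 0 else 1

zeroIf≡0⇔ : {A : Set} (a? : Dec A) → zeroIf a? ≡ 0 ⇔ A
zeroIf≡0⇔ (yes a) = mk⇔ (λ _ → a) (λ _ → refl)
zeroIf≡0⇔ (no ¬a) = mk⇔ (λ ()) (λ a → contradiction a ¬a)

Represents : Seq → (List ℕ → Set) → Set
Represents β P = ∀ s → β ⌜ s ⌝ ≡ 0 ⇔ P s

lawOf : {P : List ℕ → Set} → Decidable P → Seq
lawOf P? k = zeroIf (P? (decode k))

lawOf-represents : {P : List ℕ → Set} (P? : Decidable P) → Represents (lawOf P?) P
lawOf-represents {P} P? s =
  subst (λ t → zeroIf (P? t) ≡ 0 ⇔ P s) (sym (decode-⌜⌝ s)) (zeroIf≡0⇔ (P? s))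

F-represents : ∀ {β P} → Represents β P → ∀ α → F β α ⇔ (∀ n → P (prefix α n))
F-represents β∼P α =
  mk⇔ (λ h n → Equivalence.to (β∼P _) (h n)) (λ h n → Equivalence.from (β∼P _) (h n))

-- Zero beyond the end of the list.
toSeq : List ℕ → Seq
toSeq [] i = 0
toSeq (v ∷ u) zero = v
toSeq (v ∷ u) (suc i) = toSeq u i

toSeq-++ : ∀ u r i → i < length u → toSeq (u ++ r) i ≡ toSeq u i
toSeq-++ (v ∷ u) r zero _ = refl
toSeq-++ (v ∷ u) r (suc i) (s≤s i<n) = toSeq-++ u r i i<n

AgreeBelow : ℕ → Seq → Seq → Set
AgreeBelow n α α' = ∀ i → i < n → α i ≡ α' i

AgreeBelow-mono : ∀ {m n α α'} → m ≤ n → AgreeBelow n α α' → AgreeBelow m α α'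
AgreeBelow-mono m≤n agree i i<m = agree i (<-≤-trans i<m m≤n)

toSeq-prefix : ∀ α n → AgreeBelow n (toSeq (prefix α n)) α
toSeq-prefix α (suc n) zero _ = refl
toSeq-prefix α (suc n) (suc i) (s≤s i<n) = toSeq-prefix (λ k → α (suc k)) n i i<n

prefix-cong : ∀ {n α α'} → AgreeBelow n α α' → prefix α n ≡ prefix α' n
prefix-cong {zero} agree = refl
prefix-cong {suc n} agree =
  cong₂ _∷_ (agree 0 (s≤s z≤n)) (prefix-cong (λ i i<n → agree (suc i) (s≤s i<n)))

interleave-even : ∀ α β n → interleave α β (2 * n) ≡ α n
interleave-even α β zero = refl
interleave-even α β (suc n) rewrite 2*suc n = interleave-even (λ k → α (suc k)) (λ k → β (suc k)) n

interleave-odd : ∀ α β n → interleave α β (1 + 2 * n) ≡ β n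
interleave-odd α β zero = refl
interleave-odd α β (suc n) rewrite +-suc n (n + 0) = interleave-odd (λ k → α (suc k)) (λ k → β (suc k)) n

interleave-agree : ∀ {n α α' β β'} → AgreeBelow n α α' → AgreeBelow n β β' →
  AgreeBelow (2 * n) (interleave α β) (interleave α' β')
interleave-agree {suc n} agreeα agreeβ zero _ = agreeα 0 (s≤s z≤n)
interleave-agree {suc n} agreeα agreeβ (suc zero) _ = agreeβ 0 (s≤s z≤n)
interleave-agree {suc n} agreeα agreeβ (suc (suc i)) i<2n =
  interleave-agree {n} (λ j j<n → agreeα (suc j) (s≤s j<n)) (λ j j<n → agreeβ (suc j) (s≤s j<n)) i
    (≤-pred (≤-pred (subst (suc (suc i) <_) (2*suc n) i<2n)))

-- Function codes reading a prefix of computable length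

firstNonzero-zeros : ∀ f b → (∀ m → m < b → f m ≡ 0) → firstNonzero f b ≡ f b
firstNonzero-zeros f zero _ = refl
firstNonzero-zeros f (suc b) zeros with f 0 | zeros 0 (s≤s z≤n)
... | .0 | refl = firstNonzero-zeros (λ k → f (suc k)) b (λ m m<b → zeros (suc m) (s≤s m<b))

module _ (L : ℕ → ℕ) (g : ℕ → List ℕ → ℕ) where

  -- γⁿ waits until α has been read up to length L n and then outputs g n (ᾱ (L n)).
  localCode : Seq
  localCode k with decode k
  ... | [] = 0
  ... | n ∷ u = if does (length u ≟ L n) then suc (g n u) else 0

  localCode-prefix : ∀ n α m →
    localCode ⌜ n ∷ prefix α m ⌝ ≡ (if does (m ≟ L n) then suc (g n (prefix α m)) else 0)
  localCode-prefix n α m rewrite decode-⌜⌝ (n ∷ prefix α m) | length-applyUpTo α m = refl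

  localCode-at : ∀ n α → localCode ⌜ n ∷ prefix α (L n) ⌝ ≡ suc (g n (prefix α (L n)))
  localCode-at n α = trans (localCode-prefix n α (L n)) (if-yes (L n ≟ L n) refl)

  localCode-before : ∀ n α m → m < L n → localCode ⌜ n ∷ prefix α m ⌝ ≡ 0
  localCode-before n α m m<L = trans (localCode-prefix n α m) (if-no (m ≟ L n) (<⇒≢ m<L))

  localCode-isFunCode : IsFunCode localCode
  localCode-isFunCode n α = L n , λ γ≡0 → 1+n≢0 (trans (sym (localCode-at n α)) γ≡0)

  apply-localCode : ∀ α n → apply localCode localCode-isFunCode α n ≡ g n (prefix α (L n))
  apply-localCode α n = cong pred (begin
    firstNonzero (λ m → localCode ⌜ n ∷ prefix α m ⌝) (L n)
      ≡⟨ firstNonzero-zeros _ (L n) (localCode-before n α) ⟩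
    localCode ⌜ n ∷ prefix α (L n) ⌝
      ≡⟨ localCode-at n α ⟩
    suc (g n (prefix α (L n))) ∎)
    where open ≡-Reasoning

module LawCode {P : Seq → List ℕ → Set} (P? : ∀ α → Decidable (P α)) (L : List ℕ → ℕ)
               (P-local : ∀ {α α'} s → AgreeBelow (L s) α α' → P α s → P α' s) where

  private
    modulus : ℕ → ℕ
    modulus k = L (decode k)

    value : ℕ → List ℕ → ℕ
    value k u = lawOf (P? (toSeq u)) k

  lawCode : Seq
  lawCode = localCode modulus value

  lawCode-isFunCode : IsFunCode lawCode
  lawCode-isFunCode = localCode-isFunCode modulus value

  apply-lawCode-represents : ∀ α → Represents (apply lawCode lawCode-isFunCode α) (P α)
  apply-lawCode-represents α s =
    subst (λ v → v ≡ 0 ⇔ P α s) (sym (apply-localCode modulus value α ⌜ s ⌝))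
      (subst (λ m → lawOf (P? (toSeq (prefix α m))) ⌜ s ⌝ ≡ 0 ⇔ P α s)
             (cong L (sym (decode-⌜⌝ s)))
             (local ⇔-∘ lawOf-represents (P? (toSeq (prefix α (L s)))) s))
    where
    local : P (toSeq (prefix α (L s))) s ⇔ P α s
    local = mk⇔ (P-local s (toSeq-prefix α (L s)))
                (P-local s (λ i i<L → sym (toSeq-prefix α (L s) i i<L)))

-- Every analytic set reduces to Share(Inf)

-- A 0-1 sequence is read as a sequence of run lengths: each 1 closes a run of 0s.
runStep : List ℕ × ℕ → ℕ → List ℕ × ℕ
runStep (runs , zeros) zero = (runs , suc zeros)
runStep (runs , zeros) (suc _) = (runs ∷ʳ zeros , 0)

runState : List ℕ → List ℕ × ℕ
runState = foldl runStep ([] , 0)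

runLengths : List ℕ → List ℕ
runLengths t = proj₁ (runState t)

runState-∷ʳ : ∀ t v → runState (t ∷ʳ v) ≡ runStep (runState t) v
runState-∷ʳ t v = foldl-∷ʳ runStep ([] , 0) v t

runLengths-∷ʳ0 : ∀ t → runLengths (t ∷ʳ 0) ≡ runLengths t
runLengths-∷ʳ0 t rewrite runState-∷ʳ t 0 = refl

runLengths-∷ʳsuc : ∀ t v → runLengths (t ∷ʳ suc v) ≡ runLengths t ∷ʳ proj₂ (runState t)
runLengths-∷ʳsuc t v rewrite runState-∷ʳ t (suc v) = refl

AdmitsBelow : Seq → Seq → ℕ → Set
AdmitsBelow δ γ n = ∀ {i} → i < n → δ ⌜ prefix γ i ⌝ ≡ 0

admitsBelow? : ∀ δ γ n → Dec (AdmitsBelow δ γ n)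
admitsBelow? δ γ = allUpTo? (λ i → δ ⌜ prefix γ i ⌝ ≟ 0)

AdmitsBelow-mono : ∀ {δ γ m n} → m ≤ n → AdmitsBelow δ γ n → AdmitsBelow δ γ m
AdmitsBelow-mono m≤n admits i<m = admits (<-≤-trans i<m m≤n)

AdmitsBelow-agree : ∀ {δ γ γ' m} → AgreeBelow m γ γ' → AdmitsBelow δ γ (suc m) → AdmitsBelow δ γ' (suc m)
AdmitsBelow-agree {δ} agree admits {i} (s≤s i≤m) =
  subst (λ u → δ ⌜ u ⌝ ≡ 0) (prefix-cong (AgreeBelow-mono i≤m agree)) (admits (s≤s i≤m))

-- t is a 0-1 sequence whose run lengths b are such that δ admits ⟨α, b⟩ as far as b is known.
Consistent : Seq → Seq → List ℕ → Set
Consistent δ α t =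
  All (_≤ 1) t × AdmitsBelow δ (interleave α (toSeq (runLengths t))) (suc (2 * length (runLengths t)))

consistent? : ∀ δ α → Decidable (Consistent δ α)
consistent? δ α t = all? (_≤? 1) t ×-dec admitsBelow? δ _ _

Consistent-local : ∀ {δ α α'} t → AgreeBelow (length (runLengths t)) α α' →
  Consistent δ α t → Consistent δ α' t
Consistent-local {δ} t agree (binary , admits) =
  binary , AdmitsBelow-agree {δ} (interleave-agree agree (λ _ _ → refl)) admits

Consistent-∷ʳ0 : ∀ {δ α} t → Consistent δ α (t ∷ʳ 0) ⇔ Consistent δ α t
Consistent-∷ʳ0 {δ} {α} t rewrite runLengths-∷ʳ0 t =
  mk⇔ (λ (binary , admits) → proj₁ (∷ʳ⁻ binary) , admits)
      (λ (binary , admits) → ∷ʳ⁺ binary z≤n , admits)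

Consistent-∷ʳ1 : ∀ {δ α} t → Consistent δ α (t ∷ʳ 1) → Consistent δ α t
Consistent-∷ʳ1 {δ} {α} t (binary , admits) rewrite runLengths-∷ʳsuc t 0 =
  proj₁ (∷ʳ⁻ binary) ,
  AdmitsBelow-agree {δ} (interleave-agree {β = toSeq (runs ∷ʳ zeros)} (λ _ _ → refl) (λ i → toSeq-++ runs _ i))
    (AdmitsBelow-mono {δ} (s≤s (*-monoʳ-≤ 2 (m≤m+n (length runs) 1)))
      (subst (λ n → AdmitsBelow δ (interleave α (toSeq (runs ∷ʳ zeros))) (suc (2 * n)))
             (length-++ runs) admits))
  where
  runs = runLengths t
  zeros = proj₂ (runState t)

Consistent-∷ʳ>1 : ∀ {δ α} t i → 1 < i → ¬ Consistent δ α (t ∷ʳ i)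
Consistent-∷ʳ>1 t i 1<i (binary , _) = <⇒≱ 1<i (proj₂ (∷ʳ⁻ binary))

IsBinarySpreadLaw : Seq → Set
IsBinarySpreadLaw β =
  (∀ s → (β ⌜ s ⌝ ≡ 0) ⇔ (β ⌜ s ++ [ 0 ] ⌝ ≡ 0 ⊎ β ⌜ s ++ [ 1 ] ⌝ ≡ 0))
  × (∀ s i → 1 < i → β ⌜ s ++ [ i ] ⌝ ≢ 0)

binary⇒spreadLaw : ∀ {β} → IsBinarySpreadLaw β → IsSpreadLaw β
binary⇒spreadLaw (branch , narrow) s = mk⇔
  (λ β≡0 → [ (0 ,_) , (1 ,_) ]′ (Equivalence.to (branch s) β≡0))
  (λ { (0 , β≡0) → Equivalence.from (branch s) (inj₁ β≡0)
     ; (1 , β≡0) → Equivalence.from (branch s) (inj₂ β≡0)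
     ; (suc (suc i) , β≡0) → contradiction β≡0 (narrow s (suc (suc i)) (s≤s (s≤s z≤n))) })

represents-binarySpreadLaw : ∀ {β P} → Represents β P →
  (∀ t → P (t ∷ʳ 0) ⇔ P t) → (∀ t → P (t ∷ʳ 1) → P t) → (∀ t i → 1 < i → ¬ P (t ∷ʳ i)) →
  IsBinarySpreadLaw β
represents-binarySpreadLaw {β} {P} β∼P P-∷ʳ0 P-∷ʳ1 P-∷ʳ>1 = branch , narrow
  where
  open Equivalence
  branch : ∀ s → (β ⌜ s ⌝ ≡ 0) ⇔ (β ⌜ s ++ [ 0 ] ⌝ ≡ 0 ⊎ β ⌜ s ++ [ 1 ] ⌝ ≡ 0)
  branch s = mk⇔
    (λ β≡0 → inj₁ (from (β∼P _) (from (P-∷ʳ0 s) (to (β∼P s) β≡0))))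
    [ (λ β≡0 → from (β∼P s) (to (P-∷ʳ0 s) (to (β∼P _) β≡0)))
    , (λ β≡0 → from (β∼P s) (P-∷ʳ1 s (to (β∼P _) β≡0))) ]′
  narrow : ∀ s i → 1 < i → β ⌜ s ++ [ i ] ⌝ ≢ 0
  narrow s i 1<i β≡0 = P-∷ʳ>1 s i 1<i (to (β∼P _) β≡0)

-- The code 0^β(0) 1 0^β(1) 1 …; the state (j , a) records j emitted 1s and a 0s since the last one.
unaryStep : Seq → ℕ × ℕ → ℕ × ℕ
unaryStep β (j , a) with a ≟ β j
... | yes _ = (suc j , 0)
... | no _ = (j , suc a)

unaryState : Seq → ℕ → ℕ × ℕ
unaryState β zero = (0 , 0)
unaryState β (suc N) = unaryStep β (unaryState β N)

unaryDigit : Seq → ℕ × ℕ → ℕ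
unaryDigit β (j , a) with a ≟ β j
... | yes _ = 1
... | no _ = 0

unaryCode : Seq → Seq
unaryCode β N = unaryDigit β (unaryState β N)

unaryDigit≤1 : ∀ β state → unaryDigit β state ≤ 1
unaryDigit≤1 β (j , a) with a ≟ β j
... | yes _ = s≤s z≤n
... | no _ = z≤n

runState-unaryCode : ∀ β N →
  runState (prefix (unaryCode β) N) ≡ (prefix β (proj₁ (unaryState β N)) , proj₂ (unaryState β N))
runState-unaryCode β zero = refl
runState-unaryCode β (suc N) = begin
  runState (prefix (unaryCode β) (suc N))
    ≡⟨ cong runState (sym (applyUpTo-∷ʳ (unaryCode β) N)) ⟩
  runState (prefix (unaryCode β) N ∷ʳ unaryCode β N)
    ≡⟨ runState-∷ʳ (prefix (unaryCode β) N) (unaryCode β N) ⟩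
  runStep (runState (prefix (unaryCode β) N)) (unaryCode β N)
    ≡⟨ cong (λ state → runStep state (unaryCode β N)) (runState-unaryCode β N) ⟩
  runStep (prefix β j , a) (unaryDigit β (j , a))
    ≡⟨ step (unaryState β N) ⟩
  (prefix β (proj₁ (unaryState β (suc N))) , proj₂ (unaryState β (suc N))) ∎
  where
  open ≡-Reasoning
  j = proj₁ (unaryState β N)
  a = proj₂ (unaryState β N)
  step : ∀ state → runStep (prefix β (proj₁ state) , proj₂ state) (unaryDigit β state)
                   ≡ (prefix β (proj₁ (unaryStep β state)) , proj₂ (unaryStep β state))
  step (j , a) with a ≟ β j
  ... | yes refl = cong (_, 0) (applyUpTo-∷ʳ β j)
  ... | no _ = refl

unaryState-bounded : ∀ β N → proj₂ (unaryState β N) ≤ β (proj₁ (unaryState β N))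
unaryState-bounded β zero = z≤n
unaryState-bounded β (suc N) = step (unaryState β N) (unaryState-bounded β N)
  where
  step : ∀ state → proj₂ state ≤ β (proj₁ state) →
    proj₂ (unaryStep β state) ≤ β (proj₁ (unaryStep β state))
  step (j , a) a≤βj with a ≟ β j
  ... | yes _ = z≤n
  ... | no a≢βj = ≤∧≢⇒< a≤βj a≢βj

unaryDigit-full : ∀ β j a → a ≡ β j → unaryDigit β (j , a) ≡ 1
unaryDigit-full β j a a≡βj with a ≟ β j
... | yes _ = refl
... | no a≢βj = contradiction a≡βj a≢βj

unaryStep-short : ∀ β j a → a ≢ β j → unaryStep β (j , a) ≡ (j , suc a)
unaryStep-short β j a a≢βj with a ≟ β j
... | yes a≡βj = contradiction a≡βj a≢βj
... | no _ = refl

unaryCode-hits : ∀ β d N {j a} → unaryState β N ≡ (j , a) → a + d ≡ β j → unaryCode β (d + N) ≡ 1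
unaryCode-hits β zero N {j} {a} state≡ a+0≡βj rewrite state≡ =
  unaryDigit-full β j a (trans (sym (+-identityʳ a)) a+0≡βj)
unaryCode-hits β (suc d) N {j} {a} state≡ a+d≡βj =
  subst (λ n → unaryCode β n ≡ 1) (+-suc d N)
    (unaryCode-hits β d (suc N) next (trans (sym (+-suc a d)) a+d≡βj))
  where
  next : unaryState β (suc N) ≡ (j , suc a)
  next rewrite state≡ =
    unaryStep-short β j a (λ a≡βj → m≢1+m+n a (trans a≡βj (trans (sym a+d≡βj) (+-suc a d))))

unaryCode-Inf : ∀ β → Inf (unaryCode β)
unaryCode-Inf β = (λ n → unaryDigit≤1 β (unaryState β n)) , hitAfter
  where
  hitAfter : ∀ m → ∃ λ n → m < n × unaryCode β n ≡ 1
  hitAfter m = β j ∸ a + suc m , m≤n+m (suc m) (β j ∸ a) ,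
    unaryCode-hits β (β j ∸ a) (suc m) refl (m+[n∸m]≡n (unaryState-bounded β (suc m)))
    where
    j = proj₁ (unaryState β (suc m))
    a = proj₂ (unaryState β (suc m))

consistent-unaryCode : ∀ {δ α β} → F δ (interleave α β) → ∀ N → Consistent δ α (prefix (unaryCode β) N)
consistent-unaryCode {δ} {α} {β} admits N
  rewrite cong proj₁ (runState-unaryCode β N) | length-applyUpTo β (proj₁ (unaryState β N)) =
  applyUpTo⁺₂ (unaryCode β) N (λ n → unaryDigit≤1 β (unaryState β n)) ,
  AdmitsBelow-agree {δ}
    (interleave-agree {proj₁ (unaryState β N)} (λ _ _ → refl) (λ i i<j → sym (toSeq-prefix β _ i i<j)))
    (λ {i} _ → admits i)

toSeq-extends : ∀ {u v} r → v ≡ u ++ r → AgreeBelow (length u) (toSeq v) (toSeq u)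
toSeq-extends {u} r refl i i<n = toSeq-++ u r i i<n

module ExtendingLists (B : ℕ → List ℕ) (B-step : ∀ N → ∃ λ r → B (suc N) ≡ B N ++ r) where

  B-extends : ∀ d N → ∃ λ r → B (d + N) ≡ B N ++ r
  B-extends zero N = [] , sym (++-identityʳ (B N))
  B-extends (suc d) N with B-extends d N | B-step (d + N)
  ... | r , e | r' , e' = r ++ r' , trans e' (trans (cong (_++ r') e) (++-assoc (B N) r r'))

  B-mono : ∀ {N N'} → N ≤ N' → ∃ λ r → B N' ≡ B N ++ r
  B-mono {N} {N'} N≤N' = subst (λ M → ∃ λ r → B M ≡ B N ++ r) (m∸n+n≡m N≤N') (B-extends (N' ∸ N) N)

  length-mono : ∀ {N N'} → N ≤ N' → length (B N) ≤ length (B N')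
  length-mono {N} {N'} N≤N' with B-mono N≤N'
  ... | r , e = subst (length (B N) ≤_) (sym (trans (cong length e) (length-++ (B N))))
                      (m≤m+n (length (B N)) (length r))

  module _ (B-unbounded : ∀ k → ∃ λ N → k < length (B N)) where

    limit : Seq
    limit k = toSeq (B (proj₁ (B-unbounded k))) k

    limit-agree : ∀ N → AgreeBelow (length (B N)) limit (toSeq (B N))
    limit-agree N i i<n with B-unbounded i
    ... | M , i<m with ≤-total M N
    ...   | inj₁ M≤N = sym (toSeq-extends (proj₁ (B-mono M≤N)) (proj₂ (B-mono M≤N)) i i<m)
    ...   | inj₂ N≤M = toSeq-extends (proj₁ (B-mono N≤M)) (proj₂ (B-mono N≤M)) i i<n

module RunLengthsOfPrefixes (ζ : Seq) where

  R : ℕ → List ℕ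
  R N = runLengths (prefix ζ N)

  R-suc : ∀ N → R (suc N) ≡ runLengths (prefix ζ N ∷ʳ ζ N)
  R-suc N = cong runLengths (sym (applyUpTo-∷ʳ ζ N))

  R-step : ∀ N → ∃ λ r → R (suc N) ≡ R N ++ r
  R-step N with ζ N | R-suc N
  ... | zero | e = [] , trans e (trans (runLengths-∷ʳ0 (prefix ζ N)) (sym (++-identityʳ _)))
  ... | suc v | e = _ , trans e (runLengths-∷ʳsuc (prefix ζ N) v)

  open ExtendingLists R R-step public

  R-grows : ∀ n → ζ n ≡ 1 → suc (length (R n)) ≤ length (R (suc n))
  R-grows n ζn≡1
    rewrite R-suc n | ζn≡1 | runLengths-∷ʳsuc (prefix ζ n) 0
          | length-++ (R n) {[ proj₂ (runState (prefix ζ n)) ]} | +-comm (length (R n)) 1 = ≤-refl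

  R-unbounded : Inf ζ → ∀ k → ∃ λ N → k ≤ length (R N)
  R-unbounded inf zero = 0 , z≤n
  R-unbounded inf@(_ , ones) (suc k) with R-unbounded inf k
  ... | N , k≤ with ones N
  ...   | n , N<n , ζn≡1 = suc n , ≤-trans (s≤s (≤-trans k≤ (length-mono (<⇒≤ N<n)))) (R-grows n ζn≡1)

module _ (δ α : Seq) where

  admits-limit : ∀ ζ → Inf ζ → (∀ N → Consistent δ α (prefix ζ N)) → ∃ λ b → F δ (interleave α b)
  admits-limit ζ inf consistent = limit unbounded , admits
    where
    open RunLengthsOfPrefixes ζ
    unbounded : ∀ k → ∃ λ N → k < length (R N)
    unbounded k = R-unbounded inf (suc k)
    admits : F δ (interleave α (limit unbounded))
    admits i with R-unbounded inf i
    ... | N , i≤n =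
      AdmitsBelow-agree {δ} (interleave-agree (λ _ _ → refl) (λ j j<n → sym (limit-agree unbounded N j j<n)))
        (proj₂ (consistent N)) (s≤s (≤-trans i≤n (m≤m+n _ _)))

  share⇔admits : ∀ {β} → Represents β (Consistent δ α) → Share Inf β ⇔ (∃ λ b → F δ (interleave α b))
  share⇔admits {β} β∼C = mk⇔
    (λ (ζ , βζ , inf) → admits-limit ζ inf (Equivalence.to (F-represents {β} β∼C ζ) βζ))
    (λ (b , admits) → unaryCode b ,
       Equivalence.from (F-represents {β} β∼C (unaryCode b)) (consistent-unaryCode {δ} {α} admits) ,
       unaryCode-Inf b)

reduces-onBinary : (X : Subset) → (∀ β → IsBinarySpreadLaw β → X β ⇔ Share Inf β) →
  ∀ Y → Analytic Y → Reduces Y X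
reduces-onBinary X X⇔Share Y (δ , Y⇔) = lawCode , lawCode-isFunCode , λ α →
  let β = apply lawCode lawCode-isFunCode α
      represents = apply-lawCode-represents α
      binary = represents-binarySpreadLaw {β} represents
                 (Consistent-∷ʳ0 {δ} {α}) (Consistent-∷ʳ1 {δ} {α}) (Consistent-∷ʳ>1 {δ} {α})
  in ⇔-sym (X⇔Share β binary) ⇔-∘ (⇔-sym (share⇔admits δ α {β} represents) ⇔-∘ Y⇔ α)
  where open LawCode (consistent? δ) (λ t → length (runLengths t)) (Consistent-local {δ})

-- Closed sets given by dialogue trees

data Dialogue : Set where
  answer : Bool → Dialogue
  ask : ℕ → (ℕ → Dialogue) → Dialogue

eval : Seq → Dialogue → Bool
eval x (answer b) = b
eval x (ask i k) = eval x (k (x i))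

-- Questions beyond the end of u are treated as passed, so that failure is only reported once it is certain.
evalOn : List ℕ → Dialogue → Bool
evalOn u (answer b) = b
evalOn u (ask i k) with i <? length u
... | yes _ = evalOn u (k (toSeq u i))
... | no _ = true

queryBound : Seq → Dialogue → ℕ
queryBound x (answer b) = 0
queryBound x (ask i k) = suc i ⊔ queryBound x (k (x i))

evalOn-prefix-sound : ∀ x N d → T (eval x d) → T (evalOn (prefix x N) d)
evalOn-prefix-sound x N (answer b) t = t
evalOn-prefix-sound x N (ask i k) t with i <? length (prefix x N)
... | yes i<n rewrite toSeq-prefix x N i (subst (i <_) (length-applyUpTo x N) i<n) =
  evalOn-prefix-sound x N (k (x i)) t
... | no _ = tt

evalOn-ask : ∀ u i k → i < length u → evalOn u (ask i k) ≡ evalOn u (k (toSeq u i))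
evalOn-ask u i k i<n with i <? length u
... | yes _ = refl
... | no i≮n = contradiction i<n i≮n

evalOn-prefix-exact : ∀ x N d → queryBound x d ≤ N → evalOn (prefix x N) d ≡ eval x d
evalOn-prefix-exact x N (answer b) _ = refl
evalOn-prefix-exact x N (ask i k) bound≤N = begin
  evalOn (prefix x N) (ask i k)
    ≡⟨ evalOn-ask (prefix x N) i k (subst (i <_) (sym (length-applyUpTo x N)) i<N) ⟩
  evalOn (prefix x N) (k (toSeq (prefix x N) i))
    ≡⟨ cong (λ v → evalOn (prefix x N) (k v)) (toSeq-prefix x N i i<N) ⟩
  evalOn (prefix x N) (k (x i))
    ≡⟨ evalOn-prefix-exact x N (k (x i)) (m⊔n≤o⇒n≤o (suc i) (queryBound x (k (x i))) bound≤N) ⟩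
  eval x (k (x i)) ∎
  where
  open ≡-Reasoning
  i<N = m⊔n≤o⇒m≤o (suc i) (queryBound x (k (x i))) bound≤N

Passes : (ℕ → Dialogue) → List ℕ → Set
Passes q u = ∀ {n} → n < length u → T (evalOn u (q n))

passes? : ∀ q → Decidable (Passes q)
passes? q u = allUpTo? (λ n → T? (evalOn u (q n))) (length u)

closedBy : (ℕ → Dialogue) → Seq
closedBy q = lawOf (passes? q)

F-closedBy : ∀ q x → F (closedBy q) x ⇔ (∀ n → T (eval x (q n)))
F-closedBy q x = mk⇔ passes-all λ t →
  Equivalence.from (F-represents {closedBy q} (lawOf-represents (passes? q)) x)
    (λ N _ → evalOn-prefix-sound x N (q _) (t _))
  where
  passes-all : F (closedBy q) x → ∀ n → T (eval x (q n))
  passes-all admits n = subst T (evalOn-prefix-exact x N (q n) (m≤n+m _ (suc n)))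
    (Equivalence.to (lawOf-represents (passes? q) (prefix x N)) (admits N)
      (subst (n <_) (sym (length-applyUpTo x N)) (s≤s (m≤m+n n _))))
    where N = suc n + queryBound x (q n)

analytic-byDialogues : ∀ {X} (q : ℕ → Dialogue) →
  (∀ β → X β ⇔ ∃ λ ε → ∀ n → T (eval (interleave β ε) (q n))) → Analytic X
analytic-byDialogues q X⇔ = closedBy q , λ β →
  mk⇔ (λ xβ → let (ε , t) = Equivalence.to (X⇔ β) xβ in ε , Equivalence.from (F-closedBy q _) t)
      (λ (ε , admits) → Equivalence.from (X⇔ β) (ε , Equivalence.to (F-closedBy q _) admits))

decide : {A : Set} → Dec A → Dialogue
decide a? = answer (isYes a?)

T-decide : ∀ {A : Set} x (a? : Dec A) → T (eval x (decide a?)) ⇔ A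
T-decide x a? = mk⇔ toWitness fromWitness

infixr 5 _&_
_&_ : Dialogue → Dialogue → Dialogue
answer true & e = e
answer false & e = answer false
ask i k & e = ask i (λ v → k v & e)

T-& : ∀ x d e → T (eval x (d & e)) ⇔ (T (eval x d) × T (eval x e))
T-& x (answer true) e = mk⇔ (tt ,_) proj₂
T-& x (answer false) e = mk⇔ (λ ()) proj₁
T-& x (ask i k) e = T-& x (k (x i)) e

askList : (ℕ → ℕ) → ℕ → (List ℕ → Dialogue) → Dialogue
askList σ zero k = k []
askList σ (suc n) k = ask (σ 0) (λ v → askList (λ j → σ (suc j)) n (λ u → k (v ∷ u)))

eval-askList : ∀ x σ n k → eval x (askList σ n k) ≡ eval x (k (prefix (λ i → x (σ i)) n))
eval-askList x σ zero k = refl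
eval-askList x σ (suc n) k = eval-askList x (λ j → σ (suc j)) n (λ u → k (x (σ 0) ∷ u))

-- Share(Inf), Share*(Inf) and Share*₀₁(Inf) are analytic

InfWitness : Seq → Seq → Seq → ℕ → Set
InfWitness β ζ ν n = ζ n ≤ 1 × n < ν n × ζ (ν n) ≡ 1 × β ⌜ prefix ζ n ⌝ ≡ 0

share-Inf⇔ : ∀ β → Share Inf β ⇔ (∃₂ λ ζ ν → ∀ n → InfWitness β ζ ν n)
share-Inf⇔ β = mk⇔
  (λ (ζ , βζ , ζ≤1 , ones) →
     ζ , (λ m → proj₁ (ones m)) , λ n → let (_ , n<νn , ζνn≡1) = ones n in ζ≤1 n , n<νn , ζνn≡1 , βζ n)
  (λ (ζ , ν , witness) →
     ζ , (λ n → proj₂ (proj₂ (proj₂ (witness n)))) , (λ n → proj₁ (witness n)) ,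
     λ m → ν m , proj₁ (proj₂ (witness m)) , proj₁ (proj₂ (proj₂ (witness m))))

InfWitness-cong : ∀ {β β' ζ ζ' ν ν' : Seq} → β ≗ β' → ζ ≗ ζ' → ν ≗ ν' →
  ∀ n → InfWitness β ζ ν n → InfWitness β' ζ' ν' n
InfWitness-cong {β} {β'} {ζ} {ζ'} {ν} {ν'} β≗ ζ≗ ν≗ n (ζn≤1 , n<νn , ζνn≡1 , βζ≡0) =
  subst (_≤ 1) (ζ≗ n) ζn≤1 ,
  subst (n <_) (ν≗ n) n<νn ,
  trans (sym (ζ≗ (ν' n))) (trans (cong ζ (sym (ν≗ n))) ζνn≡1) ,
  trans (sym (β≗ _)) (trans (cong (λ u → β ⌜ u ⌝) (prefix-cong {n} (λ i _ → sym (ζ≗ i)))) βζ≡0)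

-- Here and in Narrow the code of m ∷ s stands for the pair (s , m).
Shrinks : Seq → List ℕ → Set
Shrinks β [] = ⊤
Shrinks β (m ∷ s) = β ⌜ s ++ [ m ] ⌝ ≡ 0 → β ⌜ s ⌝ ≡ 0

SpreadWitness : Seq → Seq → ℕ → Set
SpreadWitness β w n = (β ⌜ decode n ⌝ ≡ 0 → β ⌜ decode n ++ [ w n ] ⌝ ≡ 0) × Shrinks β (decode n)

isSpreadLaw⇔ : ∀ β → IsSpreadLaw β ⇔ (∃ λ w → ∀ n → SpreadWitness β w n)
isSpreadLaw⇔ β =
  mk⇔ (λ spread → choice spread , λ n → extends spread n , shrinks spread (decode n)) fromChoice
  where
  open Equivalence
  choice : IsSpreadLaw β → Seq
  choice spread n with β ⌜ decode n ⌝ ≟ 0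
  ... | yes β≡0 = proj₁ (to (spread (decode n)) β≡0)
  ... | no _ = 0
  extends : ∀ spread n → β ⌜ decode n ⌝ ≡ 0 → β ⌜ decode n ++ [ choice spread n ] ⌝ ≡ 0
  extends spread n β≡0 with β ⌜ decode n ⌝ ≟ 0
  ... | yes β≡0' = proj₂ (to (spread (decode n)) β≡0')
  ... | no β≢0 = contradiction β≡0 β≢0
  shrinks : IsSpreadLaw β → ∀ t → Shrinks β t
  shrinks spread [] = tt
  shrinks spread (m ∷ s) β≡0 = from (spread s) (m , β≡0)
  fromChoice : (∃ λ w → ∀ n → SpreadWitness β w n) → IsSpreadLaw β
  fromChoice (w , witness) s = mk⇔
    (λ β≡0 → w ⌜ s ⌝ , subst (λ t → β ⌜ t ⌝ ≡ 0 → β ⌜ t ++ [ w ⌜ s ⌝ ] ⌝ ≡ 0) (decode-⌜⌝ s)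
                          (proj₁ (witness ⌜ s ⌝)) β≡0)
    (λ (m , β≡0) → subst (Shrinks β) (decode-⌜⌝ (m ∷ s)) (proj₂ (witness ⌜ m ∷ s ⌝)) β≡0)

≗-zero : ∀ {β β' : Seq} → β ≗ β' → ∀ {k} → β k ≡ 0 → β' k ≡ 0
≗-zero β≗ {k} = trans (sym (β≗ k))

Shrinks-cong : ∀ {β β' : Seq} → β ≗ β' → ∀ t → Shrinks β t → Shrinks β' t
Shrinks-cong β≗ [] _ = tt
Shrinks-cong β≗ (m ∷ s) shrinks β'≡0 = ≗-zero β≗ (shrinks (≗-zero (λ k → sym (β≗ k)) β'≡0))

SpreadWitness-cong : ∀ {β β' w w' : Seq} → β ≗ β' → w ≗ w' →
  ∀ n → SpreadWitness β w n → SpreadWitness β' w' n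
SpreadWitness-cong {β} β≗ w≗ n (extends , shrinks) =
  (λ β'≡0 → ≗-zero β≗ (subst (λ m → β ⌜ decode n ++ [ m ] ⌝ ≡ 0) (w≗ n)
                             (extends (≗-zero (λ k → sym (β≗ k)) β'≡0)))) ,
  Shrinks-cong β≗ (decode n) shrinks

Branches : Seq → List ℕ → Set
Branches β s = (β ⌜ s ⌝ ≡ 0 → β ⌜ s ++ [ 0 ] ⌝ ≡ 0 ⊎ β ⌜ s ++ [ 1 ] ⌝ ≡ 0)
             × (β ⌜ s ++ [ 0 ] ⌝ ≡ 0 ⊎ β ⌜ s ++ [ 1 ] ⌝ ≡ 0 → β ⌜ s ⌝ ≡ 0)

Narrow : Seq → List ℕ → Set
Narrow β [] = ⊤
Narrow β (i ∷ s) = 1 < i → β ⌜ s ++ [ i ] ⌝ ≢ 0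

BinaryWitness : Seq → ℕ → Set
BinaryWitness β n = Branches β (decode n) × Narrow β (decode n)

isBinarySpreadLaw⇔ : ∀ β → IsBinarySpreadLaw β ⇔ (∀ n → BinaryWitness β n)
isBinarySpreadLaw⇔ β = mk⇔
  (λ (branch , narrow) n → (Equivalence.to (branch (decode n)) , Equivalence.from (branch (decode n))) ,
                           narrowAll narrow (decode n))
  (λ witness →
     (λ s → let (to , from) = subst (Branches β) (decode-⌜⌝ s) (proj₁ (witness ⌜ s ⌝)) in mk⇔ to from) ,
     (λ s i → subst (Narrow β) (decode-⌜⌝ (i ∷ s)) (proj₂ (witness ⌜ i ∷ s ⌝))))
  where
  narrowAll : (∀ s i → 1 < i → β ⌜ s ++ [ i ] ⌝ ≢ 0) → ∀ t → Narrow β t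
  narrowAll narrow [] = tt
  narrowAll narrow (i ∷ s) = narrow s i

BinaryWitness-cong : ∀ {β β' : Seq} → β ≗ β' → ∀ n → BinaryWitness β n → BinaryWitness β' n
BinaryWitness-cong {β} {β'} β≗ n ((to , from) , narrow) =
  ((λ β'≡0 → map-⊎ (≗-zero β≗) (≗-zero β≗) (to (≗-zero β'≗ β'≡0))) ,
   (λ β'≡0 → ≗-zero β≗ (from (map-⊎ (≗-zero β'≗) (≗-zero β'≗) β'≡0)))) ,
  narrowCong (decode n) narrow
  where
  β'≗ : β' ≗ β
  β'≗ k = sym (β≗ k)
  narrowCong : ∀ t → Narrow β t → Narrow β' t
  narrowCong [] _ = tt
  narrowCong (i ∷ s) narrow 1<i β'≡0 = narrow 1<i (≗-zero β'≗ β'≡0)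

-- The positions of β, ζ, ν and w in ⟨β , ⟨ζ , ⟨ν , w⟩⟩⟩.
posβ posζ posν posw : ℕ → ℕ
posβ k = 2 * k
posζ i = 1 + 2 * (2 * i)
posν m = 1 + 2 * (1 + 2 * (2 * m))
posw n = 1 + 2 * (1 + 2 * (1 + 2 * n))

encodeWitness : Seq → Seq → Seq → Seq
encodeWitness ζ ν w = interleave ζ (interleave ν w)

module _ (β ζ ν w : Seq) where
  private
    x = interleave β (encodeWitness ζ ν w)

  encodeWitness-posζ : (λ i → x (posζ i)) ≗ ζ
  encodeWitness-posζ i =
    trans (interleave-odd β (encodeWitness ζ ν w) (2 * i)) (interleave-even ζ (interleave ν w) i)

  encodeWitness-posν : (λ m → x (posν m)) ≗ ν
  encodeWitness-posν m =
    trans (interleave-odd β (encodeWitness ζ ν w) (1 + 2 * (2 * m)))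
          (trans (interleave-odd ζ (interleave ν w) (2 * m)) (interleave-even ν w m))

  encodeWitness-posw : (λ n → x (posw n)) ≗ w
  encodeWitness-posw n =
    trans (interleave-odd β (encodeWitness ζ ν w) (1 + 2 * (1 + 2 * n)))
          (trans (interleave-odd ζ (interleave ν w) (1 + 2 * n)) (interleave-odd ν w n))

analytic-byWitnesses : ∀ {X} (q : ℕ → Dialogue) (C : Seq → Seq → Seq → Seq → ℕ → Set) →
  (∀ {β β' ζ ζ' ν ν' w w'} → β ≗ β' → ζ ≗ ζ' → ν ≗ ν' → w ≗ w' →
     ∀ n → C β ζ ν w n → C β' ζ' ν' w' n) →
  (∀ x n → T (eval x (q n))
         ⇔ C (λ k → x (posβ k)) (λ i → x (posζ i)) (λ m → x (posν m)) (λ n → x (posw n)) n) →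
  (∀ β → X β ⇔ (∃₂ λ ζ ν → ∃ λ w → ∀ n → C β ζ ν w n)) →
  Analytic X
analytic-byWitnesses {X} q C C-cong T-q X⇔ = analytic-byDialogues q λ β → mk⇔
  (λ xβ → let (ζ , ν , w , c) = Equivalence.to (X⇔ β) xβ in
     encodeWitness ζ ν w , λ n → Equivalence.from (T-q _ n)
       (C-cong (λ k → sym (interleave-even β _ k)) (λ i → sym (encodeWitness-posζ β ζ ν w i))
               (λ m → sym (encodeWitness-posν β ζ ν w m)) (λ n → sym (encodeWitness-posw β ζ ν w n))
               n (c n)))
  (λ (ε , t) → let x = interleave β ε in Equivalence.from (X⇔ β)
     ((λ i → x (posζ i)) , (λ m → x (posν m)) , (λ n → x (posw n)) , λ n →
       C-cong (interleave-even β ε) (λ _ → refl) (λ _ → refl) (λ _ → refl)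
              n (Equivalence.to (T-q x n) (t n))))

infWitnessCheck : ℕ → ℕ → ℕ → ℕ → List ℕ → Dialogue
infWitnessCheck n ζn νn ζνn ζ̄n =
  ask (posβ ⌜ ζ̄n ⌝) λ b → decide (ζn ≤? 1 ×-dec n <? νn ×-dec ζνn ≟ 1 ×-dec b ≟ 0)

infWitnessQuery : ℕ → Dialogue
infWitnessQuery n =
  ask (posζ n) λ ζn → ask (posν n) λ νn → ask (posζ νn) λ ζνn →
  askList posζ n (infWitnessCheck n ζn νn ζνn)

T-infWitnessQuery : ∀ x n →
  T (eval x (infWitnessQuery n)) ⇔ InfWitness (λ k → x (posβ k)) (λ i → x (posζ i)) (λ m → x (posν m)) n
T-infWitnessQuery x n =
  subst (λ b → T b ⇔ InfWitness (λ k → x (posβ k)) ζ (λ m → x (posν m)) n)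
    (sym (eval-askList x posζ n (infWitnessCheck n (ζ n) (x (posν n)) (ζ (x (posν n))))))
    (T-decide x _)
  where
  ζ : Seq
  ζ i = x (posζ i)

shrinksQuery : List ℕ → Dialogue
shrinksQuery [] = answer true
shrinksQuery (m ∷ s) =
  ask (posβ ⌜ s ++ [ m ] ⌝) λ b → ask (posβ ⌜ s ⌝) λ b' → decide (b ≟ 0 →-dec b' ≟ 0)

T-shrinksQuery : ∀ x t → T (eval x (shrinksQuery t)) ⇔ Shrinks (λ k → x (posβ k)) t
T-shrinksQuery x [] = mk⇔ (λ _ → tt) (λ _ → tt)
T-shrinksQuery x (m ∷ s) = T-decide x _

extendsQuery : ℕ → Dialogue
extendsQuery n =
  ask (posβ ⌜ decode n ⌝) λ b → ask (posw n) λ m → ask (posβ ⌜ decode n ++ [ m ] ⌝) λ b' →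
  decide (b ≟ 0 →-dec b' ≟ 0)

spreadWitnessQuery : ℕ → Dialogue
spreadWitnessQuery n = extendsQuery n & shrinksQuery (decode n)

T-spreadWitnessQuery : ∀ x n →
  T (eval x (spreadWitnessQuery n)) ⇔ SpreadWitness (λ k → x (posβ k)) (λ n → x (posw n)) n
T-spreadWitnessQuery x n =
  (T-decide x _ ×-⇔ T-shrinksQuery x (decode n)) ⇔-∘ T-& x (extendsQuery n) (shrinksQuery (decode n))

narrowQuery : List ℕ → Dialogue
narrowQuery [] = answer true
narrowQuery (i ∷ s) = ask (posβ ⌜ s ++ [ i ] ⌝) λ b → decide (1 <? i →-dec ¬? (b ≟ 0))

T-narrowQuery : ∀ x t → T (eval x (narrowQuery t)) ⇔ Narrow (λ k → x (posβ k)) t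
T-narrowQuery x [] = mk⇔ (λ _ → tt) (λ _ → tt)
T-narrowQuery x (i ∷ s) = T-decide x _

branchesQuery : List ℕ → Dialogue
branchesQuery s =
  ask (posβ ⌜ s ⌝) λ b → ask (posβ ⌜ s ++ [ 0 ] ⌝) λ b₀ → ask (posβ ⌜ s ++ [ 1 ] ⌝) λ b₁ →
  decide ((b ≟ 0 →-dec (b₀ ≟ 0 ⊎-dec b₁ ≟ 0)) ×-dec ((b₀ ≟ 0 ⊎-dec b₁ ≟ 0) →-dec b ≟ 0))

binaryWitnessQuery : ℕ → Dialogue
binaryWitnessQuery n = branchesQuery (decode n) & narrowQuery (decode n)

T-binaryWitnessQuery : ∀ x n → T (eval x (binaryWitnessQuery n)) ⇔ BinaryWitness (λ k → x (posβ k)) n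
T-binaryWitnessQuery x n =
  (T-decide x _ ×-⇔ T-narrowQuery x (decode n)) ⇔-∘ T-& x (branchesQuery (decode n)) (narrowQuery (decode n))

share-analytic : Analytic (Share Inf)
share-analytic =
  analytic-byWitnesses infWitnessQuery (λ β ζ ν _ → InfWitness β ζ ν)
    (λ β≗ ζ≗ ν≗ _ → InfWitness-cong β≗ ζ≗ ν≗) T-infWitnessQuery λ β → mk⇔
    (λ shares → let (ζ , ν , inf) = Equivalence.to (share-Inf⇔ β) shares in ζ , ν , (λ _ → 0) , inf)
    (λ (ζ , ν , _ , inf) → Equivalence.from (share-Inf⇔ β) (ζ , ν , inf))

share*-analytic : Analytic (Share* Inf)
share*-analytic =
  analytic-byWitnesses (λ n → infWitnessQuery n & spreadWitnessQuery n)
    (λ β ζ ν w n → InfWitness β ζ ν n × SpreadWitness β w n)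
    (λ β≗ ζ≗ ν≗ w≗ n (inf , spread) → InfWitness-cong β≗ ζ≗ ν≗ n inf , SpreadWitness-cong β≗ w≗ n spread)
    (λ x n → (T-infWitnessQuery x n ×-⇔ T-spreadWitnessQuery x n)
               ⇔-∘ T-& x (infWitnessQuery n) (spreadWitnessQuery n))
    λ β → mk⇔
    (λ (spread , shares) →
       let (w , extend) = Equivalence.to (isSpreadLaw⇔ β) spread
           (ζ , ν , inf) = Equivalence.to (share-Inf⇔ β) shares
       in ζ , ν , w , λ n → inf n , extend n)
    (λ (ζ , ν , w , c) →
       Equivalence.from (isSpreadLaw⇔ β) (w , λ n → proj₂ (c n)) ,
       Equivalence.from (share-Inf⇔ β) (ζ , ν , λ n → proj₁ (c n)))

share*01-analytic : Analytic (Share*01 Inf)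
share*01-analytic =
  analytic-byWitnesses (λ n → infWitnessQuery n & binaryWitnessQuery n)
    (λ β ζ ν _ n → InfWitness β ζ ν n × BinaryWitness β n)
    (λ β≗ ζ≗ ν≗ _ n (inf , binary) → InfWitness-cong β≗ ζ≗ ν≗ n inf , BinaryWitness-cong β≗ n binary)
    (λ x n → (T-infWitnessQuery x n ×-⇔ T-binaryWitnessQuery x n)
               ⇔-∘ T-& x (infWitnessQuery n) (binaryWitnessQuery n))
    λ β → mk⇔
    (λ (shares , binary) →
       let (ζ , ν , inf) = Equivalence.to (share-Inf⇔ β) shares
       in ζ , ν , (λ _ → 0) , λ n → inf n , Equivalence.to (isBinarySpreadLaw⇔ β) binary n)
    (λ (ζ , ν , _ , c) →
       Equivalence.from (share-Inf⇔ β) (ζ , ν , λ n → proj₁ (c n)) ,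
       Equivalence.from (isBinarySpreadLaw⇔ β) (λ n → proj₂ (c n)))

theorem2p5 : CompleteAnalytic (Share Inf)
    × CompleteAnalytic (Share* Inf)
    × CompleteAnalytic (Share*01 Inf)
theorem2p5 =
  (share-analytic , reduces-onBinary (Share Inf) (λ β _ → mk⇔ id id)) ,
  (share*-analytic , reduces-onBinary (Share* Inf) (λ β binary → mk⇔ proj₂ (binary⇒spreadLaw {β} binary ,_))) ,
  (share*01-analytic , reduces-onBinary (Share*01 Inf) (λ β binary → mk⇔ proj₁ (_, binary)))
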